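{- Let $w$ be an infinite word such that $\mathcal{A}_n(w)=1$ for every even $n\ge 0$ and $\mathcal{A}_n(w)=2$ for every odd $n\ge 0$. Then $w$ is aperiodic (not ultimately periodic).
   Context: A complete first return to a word $u$ is a word that starts with $u$, ends with $u$, and contains exactly two occurrences of $u$. Privileged words are defined recursively: the empty word is privileged; every letter is privileged; a word of length at least $2$ is privileged if it is a complete first return to a shorter privileged word. $\mathcal{A}_n(w)$ is the number of distinct privileged factors of $w$ of length $n$. An infinite word is ultimately periodic if it equals $uv^\omega$ for finite words $u,v$ with $v$ nonempty, and aperiodic otherwise. -}

module Defs where

open import Data.Nat using (ℕ; zero; suc; _+_; _<_; _≤_; _∸_)
open import Data.Nat.DivMod using (_mod_)
open import Data.List using (List; []; _∷_; length; take; drop; lookup)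
open import Data.List.Relation.Unary.All using (All)
open import Data.List.Relation.Unary.Unique.Propositional using (Unique)
open import Data.List.Membership.Propositional using (_∈_)
open import Data.Product using (Σ; ∃; _×_)
open import Relation.Binary.PropositionalEquality using (_≡_)
open import Relation.Nullary using (¬_)

factor : {A : Set} → (ℕ → A) → ℕ → ℕ → List A
factor w i zero    = []
factor w i (suc n) = w i ∷ factor w (suc i) n

OccursAt : {A : Set} → List A → List A → ℕ → Set
OccursAt u v i = take (length u) (drop i v) ≡ u × (i + length u) ≤ length v

CompleteFirstReturn : {A : Set} → List A → List A → Set
CompleteFirstReturn u v =
  OccursAt u v 0 ×
  OccursAt u v (length v ∸ length u) ×
  length u < length v ×
  (∀ i → 0 < i → i < length v ∸ length u → ¬ OccursAt u v i)

data Privileged {A : Set} : List A → Set where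
  priv-empty  : Privileged []
  priv-letter : (a : A) → Privileged (a ∷ [])
  priv-return : {u v : List A} → Privileged u → 2 ≤ length v →
                CompleteFirstReturn u v → Privileged v

PrivFactor : {A : Set} → (ℕ → A) → ℕ → List A → Set
PrivFactor w n u = Privileged u × ∃ λ i → factor w i n ≡ u

-- 𝒜ₙ(w) = k : there are exactly k distinct privileged factors of w of length n
PrivCount : {A : Set} → (ℕ → A) → ℕ → ℕ → Set
PrivCount {A} w n k =
  Σ (List (List A)) λ us →
    length us ≡ k × Unique us × All (PrivFactor w n) us ×
    (∀ u → PrivFactor w n u → u ∈ us)

-- u v^ω, with v = a ∷ vs nonempty
uvω : {A : Set} → List A → A → List A → ℕ → A
uvω []      a vs i       = lookup (a ∷ vs) (i mod (suc (length vs)))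
uvω (x ∷ u) a vs zero    = x
uvω (x ∷ u) a vs (suc i) = uvω u a vs i

UltimatelyPeriodic : {A : Set} → (ℕ → A) → Set
UltimatelyPeriodic {A} w =
  Σ (List A) λ u → Σ A λ a → Σ (List A) λ vs → ∀ i → w i ≡ uvω u a vs i

Aperiodic : {A : Set} → (ℕ → A) → Set
Aperiodic w = ¬ UltimatelyPeriodic w

-- Suppose w had an eventual period, and let p be the least one, say w i = w (i + p) for
-- i ≥ K.  Two facts about privileged words drive the argument.  (1) A privileged word of
-- length ≥ 2 is a complete first return to a privileged prefix u; its return time d = n − |u|
-- is the least shift of u back onto itself (return-decomposition).  (2) Consequently every
-- privileged prefix of a privileged word is also a suffix (privileged-border).
-- Periodicity then gives: every privileged factor longer than a bound B occurs at a position
-- K + r with "phase" r < p (late-phase), and two privileged factors at the same phase with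
-- lengths in a window [N, N + p), N > B, are equal, since otherwise the shorter would be a
-- border of the longer and their length difference (< p) would be a smaller eventual period
-- (phase-separates).  But for odd N the lengths N, …, N + p − 1 carry at least 2 + (p − 1)
-- distinct privileged factors, hence p + 1 distinct phases below p: impossible by the
-- pigeonhole principle (Least-Period.impossible).  Strong induction on p concludes.

module Submission where

open import Defs
open import Data.Nat using (ℕ; zero; suc; pred; _+_; _*_; _∸_; _≤_; _<_; z≤n; s≤s; z<s; _≤?_; NonZero; >-nonZero; >-nonZero⁻¹)
open import Data.Nat.DivMod using (_%_; _/_; m≡m%n+[m/n]*n; m%n<n; [m+n]%n≡m%n)
open import Data.Nat.Properties
open import Algebra.Properties.CommutativeSemigroup +-commutativeSemigroup using (interchange; x∙yz≈xz∙y; xy∙z≈xz∙y)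
open import Data.Nat.Induction using (<-rec)
open import Data.Nat.Tactic.RingSolver using (solve-∀)
open import Data.Fin using (Fin; fromℕ<) renaming (_<_ to _<ᶠ_)
open import Data.Fin.Properties using (pigeonhole; fromℕ<-injective; fromℕ<-cong)
open import Data.List using (List; []; _∷_; length; take; drop; map; _++_; lookup)
open import Data.List.Properties using (∷-injectiveˡ; ∷-injectiveʳ; length-map; length-++)
open import Data.List.Membership.Propositional using (_∈_)
open import Data.List.Membership.Propositional.Properties using (∈-lookup)
open import Data.List.Relation.Unary.All as All using (All; []; _∷_)
import Data.List.Relation.Unary.All.Properties as All
open import Data.List.Relation.Unary.AllPairs using ([]; _∷_)
open import Data.List.Relation.Unary.Unique.Propositional using (Unique)
import Data.List.Relation.Unary.Unique.Propositional.Properties as Unique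
open import Data.Product using (Σ; ∃; _×_; _,_)
open import Data.Empty using (⊥)
open import Data.Sum using (_⊎_; inj₁; inj₂)
open import Relation.Nullary using (¬_; contradiction; yes; no)
open import Relation.Binary.PropositionalEquality

additive-compare : ∀ a b → (∃ λ g → a + g ≡ b) ⊎ (∃ λ g → 0 < g × b + g ≡ a)
additive-compare a b with ≤-<-connex a b
... | inj₁ a≤b = inj₁ (b ∸ a , m+[n∸m]≡n a≤b)
... | inj₂ b<a = inj₂ (a ∸ b , m<n⇒0<n∸m b<a , m+[n∸m]≡n (<⇒≤ b<a))

even-or-odd : ∀ s → (∃ λ q → 2 * q ≡ s) ⊎ (∃ λ q → suc (2 * q) ≡ s)
even-or-odd zero = inj₁ (0 , refl)
even-or-odd (suc s) with even-or-odd s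
... | inj₁ (q , refl) = inj₂ (q , refl)
... | inj₂ (q , refl) = inj₁ (suc q , cong suc (+-suc q (q + 0)))

preimage : ∀ {X Y : Set} {P : X → Set} (f : X → Y) (ys : List Y) →
           All (λ y → Σ X λ x → P x × f x ≡ y) ys → Σ (List X) λ xs → map f xs ≡ ys × All P xs
preimage f []       []                     = [] , refl , []
preimage f (y ∷ ys) ((x , px , refl) ∷ rest) with xs , refl , pxs ← preimage f ys rest =
  x ∷ xs , refl , px ∷ pxs

lookup-distinct : ∀ {X : Set} {xs : List X} → Unique xs → ∀ {i j} → i <ᶠ j → lookup xs i ≢ lookup xs j
lookup-distinct {xs = x ∷ xs} (x∉xs ∷ _) {Fin.zero}  {Fin.suc j} _         = All.lookup x∉xs (∈-lookup j)
lookup-distinct {xs = x ∷ xs} (_ ∷ rest) {Fin.suc i} {Fin.suc j} (s≤s i<j) = lookup-distinct rest i<j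

unique-below : ∀ p (xs : List ℕ) → Unique xs → All (_< p) xs → length xs ≤ p
unique-below p xs unique bounded = ≮⇒≥ λ p<|xs| →
  let i , j , i<j , same = pigeonhole p<|xs| (λ i → fromℕ< (bound i))
  in lookup-distinct unique i<j (fromℕ<-injective _ _ (bound i) (bound j) same)
  where
  bound : (i : Fin (length xs)) → lookup xs i < p
  bound i = All.lookup bounded (∈-lookup i)

module Factors {A : Set} (w : ℕ → A) where

  Agree : ℕ → ℕ → ℕ → Set
  Agree a b L = ∀ k → k < L → w (a + k) ≡ w (b + k)

  reindex : ∀ {a a′ b b′} → a ≡ a′ → b ≡ b′ → w a ≡ w b → w a′ ≡ w b′
  reindex refl refl eq = eq

  factor-length : ∀ a L → length (factor w a L) ≡ L
  factor-length a zero    = refl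
  factor-length a (suc L) = cong suc (factor-length (suc a) L)

  factor≡⇒Agree : ∀ a b L → factor w a L ≡ factor w b L → Agree a b L
  factor≡⇒Agree a b (suc L) eq zero    _          =
    reindex (sym (+-identityʳ a)) (sym (+-identityʳ b)) (∷-injectiveˡ eq)
  factor≡⇒Agree a b (suc L) eq (suc k) (s≤s k<L) =
    reindex (sym (+-suc a k)) (sym (+-suc b k)) (factor≡⇒Agree (suc a) (suc b) L (∷-injectiveʳ eq) k k<L)

  Agree⇒factor≡ : ∀ a b L → Agree a b L → factor w a L ≡ factor w b L
  Agree⇒factor≡ a b zero    _  = refl
  Agree⇒factor≡ a b (suc L) ag = cong₂ _∷_ head (Agree⇒factor≡ (suc a) (suc b) L tail)
    where
    head : w a ≡ w b
    head = reindex (+-identityʳ a) (+-identityʳ b) (ag 0 (s≤s z≤n))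
    tail : Agree (suc a) (suc b) L
    tail k k<L = reindex (+-suc a k) (+-suc b k) (ag (suc k) (s≤s k<L))

  take-factor : ∀ a {m} L → m ≤ L → take m (factor w a L) ≡ factor w a m
  take-factor a L       z≤n       = refl
  take-factor a (suc L) (s≤s m≤L) = cong (w a ∷_) (take-factor (suc a) L m≤L)

  drop-factor : ∀ a j L → drop j (factor w a L) ≡ factor w (a + j) (L ∸ j)
  drop-factor a zero    L       = cong (λ b → factor w b L) (sym (+-identityʳ a))
  drop-factor a (suc j) zero    = refl
  drop-factor a (suc j) (suc L) =
    trans (drop-factor (suc a) j L) (cong (λ b → factor w b (L ∸ j)) (sym (+-suc a j)))

  occurrence⇒factor : ∀ u i n j → OccursAt u (factor w i n) j → factor w (i + j) (length u) ≡ u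
  occurrence⇒factor u i n j (eq , fits) = begin
      factor w (i + j) (length u)                 ≡⟨ take-factor (i + j) (n ∸ j) |u|≤n∸j ⟨
      take (length u) (factor w (i + j) (n ∸ j))  ≡⟨ cong (take (length u)) (drop-factor i j n) ⟨
      take (length u) (drop j (factor w i n))     ≡⟨ eq ⟩
      u                                           ∎
    where
    open ≡-Reasoning
    |u|≤n∸j : length u ≤ n ∸ j
    |u|≤n∸j = m+n≤o⇒m≤o∸n (length u)
                (subst₂ _≤_ (+-comm j (length u)) (factor-length i n) fits)

  factor⇒occurrence : ∀ u i n j → factor w (i + j) (length u) ≡ u → j + length u ≤ n →
                      OccursAt u (factor w i n) j
  factor⇒occurrence u i n j eq fits =
    trans (cong (take (length u)) (drop-factor i j n))
          (trans (take-factor (i + j) (n ∸ j) |u|≤n∸j) eq) ,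
    subst (j + length u ≤_) (sym (factor-length i n)) fits
    where
    |u|≤n∸j : length u ≤ n ∸ j
    |u|≤n∸j = m+n≤o⇒m≤o∸n (length u) (subst (_≤ n) (+-comm j (length u)) fits)

  agree-iterate : ∀ {i d m} → Agree i (i + d) m → ∀ t k → k + t * d < m + d →
                  w (i + k) ≡ w (i + k + t * d)
  agree-iterate {i} ag zero    k _ = cong w (sym (+-identityʳ (i + k)))
  agree-iterate {i} {d} {m} ag (suc t) k bound = begin
      w (i + k)                 ≡⟨ agree-iterate ag t k (≤-<-trans (+-monoʳ-≤ k (m≤n+m (t * d) d)) bound) ⟩
      w (i + k + t * d)         ≡⟨ cong w (+-assoc i k (t * d)) ⟩
      w (i + (k + t * d))       ≡⟨ ag (k + t * d) inside ⟩
      w (i + d + (k + t * d))   ≡⟨ cong w (interchange i d k (t * d)) ⟩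
      w (i + k + suc t * d)     ∎
    where
    open ≡-Reasoning
    inside : k + t * d < m
    inside = +-cancelʳ-< d (k + t * d) m (subst (_< m + d) (x∙yz≈xz∙y k d (t * d)) bound)

module Privileged-Factors {A : Set} (w : ℕ → A) where
  open Factors w

  record Return (i n : ℕ) : Set where
    field
      ℓ d               : ℕ
      ℓ+d≡n             : ℓ + d ≡ n
      0<d               : 0 < d
      prefix-privileged : Privileged (factor w i ℓ)
      returns           : Agree i (i + d) ℓ
      first             : ∀ j → 0 < j → j < d → ¬ Agree i (i + j) ℓ

  return-decomposition : ∀ {i n} → Privileged (factor w i n) → 2 ≤ n → Return i n
  return-decomposition {i} {n} priv = decompose priv refl
    where
    length≡n : ∀ {x} → factor w i n ≡ x → n ≡ length x
    length≡n eq = trans (sym (factor-length i n)) (cong length eq)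

    decompose : ∀ {x} → Privileged x → factor w i n ≡ x → 2 ≤ n → Return i n
    decompose priv-empty      eq 2≤n = contradiction (subst (2 ≤_) (length≡n eq) 2≤n) λ ()
    decompose (priv-letter a) eq 2≤n = contradiction (subst (2 ≤_) (length≡n eq) 2≤n) λ { (s≤s ()) }
    decompose (priv-return {u} privU _ (atStart , atEnd , shorter , noMiddle)) refl _ = record
      { ℓ = length u ; d = n ∸ length u ; ℓ+d≡n = m+[n∸m]≡n (<⇒≤ |u|<n) ; 0<d = m<n⇒0<n∸m |u|<n
      ; prefix-privileged = subst Privileged (sym prefix) privU
      ; returns = factor≡⇒Agree i (i + (n ∸ length u)) (length u) (trans prefix (sym suffix))
      ; first = no-earlier-return
      }
      where
      |u|<n : length u < n
      |u|<n = subst (length u <_) (factor-length i n) shorter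
      prefix : factor w i (length u) ≡ u
      prefix = trans (cong (λ a → factor w a (length u)) (sym (+-identityʳ i)))
                     (occurrence⇒factor u i n 0 atStart)
      suffix : factor w (i + (n ∸ length u)) (length u) ≡ u
      suffix = trans (cong (λ L → factor w (i + (L ∸ length u)) (length u)) (sym (factor-length i n)))
                     (occurrence⇒factor u i n _ atEnd)
      -- an earlier return of u would be an occurrence strictly inside the factor
      no-earlier-return : ∀ j → 0 < j → j < n ∸ length u → ¬ Agree i (i + j) (length u)
      no-earlier-return j 0<j j<d ag =
        noMiddle j 0<j (subst (λ L → j < L ∸ length u) (sym (factor-length i n)) j<d)
          (factor⇒occurrence u i n j (trans (sym (Agree⇒factor≡ i (i + j) (length u) ag)) prefix)
             (m≤o∸n⇒m+n≤o j (<⇒≤ |u|<n) (<⇒≤ j<d)))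

  -- A privileged prefix of a privileged factor is also a suffix of it (a border).  By strong
  -- induction on the length, comparing the prefix with the returning prefix of the factor.
  privileged-border : ∀ n i m e → m + e ≡ n → Privileged (factor w i n) →
                      Privileged (factor w i m) → Agree i (i + e) m
  privileged-border = <-rec _ border
    where
    Border : ℕ → Set
    Border n = ∀ i m e → m + e ≡ n → Privileged (factor w i n) →
               Privileged (factor w i m) → Agree i (i + e) m

    border : ∀ n → (∀ {n′} → n′ < n → Border n′) → Border n
    border n ih i m       zero    _ _ _ k _ = cong w (cong (_+ k) (sym (+-identityʳ i)))
    border n ih i zero    (suc e) _ _ _ k ()
    border n ih i (suc m) (suc e) refl privN privM
      with R ← return-decomposition privN (s≤s (≤-trans (s≤s z≤n) (m≤n+m (suc e) m)))
      with additive-compare (suc m) (Return.ℓ R)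
    ... | inj₁ (g , M+g≡ℓ) = λ k k<M → begin
          w (i + k)             ≡⟨ prefix-border k k<M ⟩
          w (i + g + k)         ≡⟨ cong w (+-assoc i g k) ⟩
          w (i + (g + k))       ≡⟨ returns (g + k) (subst (g + k <_) (trans (+-comm g (suc m)) M+g≡ℓ) (+-monoʳ-< g k<M)) ⟩
          w (i + d + (g + k))   ≡⟨ cong w (regroup i d g k) ⟩
          w (i + (g + d) + k)   ≡⟨ cong (λ x → w (i + x + k)) g+d≡e ⟩
          w (i + suc e + k)     ∎
      where
      open Return R
      open ≡-Reasoning
      regroup : ∀ i d g k → i + d + (g + k) ≡ i + (g + d) + k
      regroup = solve-∀
      -- the prefix of length 1 + m is a border of the returning prefix
      prefix-border : Agree i (i + g) (suc m)
      prefix-border = ih (subst (ℓ <_) ℓ+d≡n (m<m+n ℓ 0<d)) i (suc m) g M+g≡ℓ prefix-privileged privM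
      g+d≡e : g + d ≡ suc e
      g+d≡e = +-cancelˡ-≡ (suc m) (g + d) (suc e)
                (trans (sym (+-assoc (suc m) g d)) (trans (cong (_+ d) M+g≡ℓ) ℓ+d≡n))
    ... | inj₂ (g , 0<g , ℓ+g≡M) = contradiction returning-prefix-border (first g 0<g g<d)
      where
      open Return R
      M<n : suc m < suc m + suc e
      M<n = m<m+n (suc m) (s≤s z≤n)
      g<d : g < d
      g<d = +-cancelˡ-< ℓ g d (subst₂ _<_ (sym ℓ+g≡M) (sym ℓ+d≡n) M<n)
      -- the returning prefix would then be a border of the prefix of length 1 + m,
      -- i.e. it would return already after g < d steps
      returning-prefix-border : Agree i (i + g) ℓ
      returning-prefix-border = ih M<n i ℓ g ℓ+g≡M privM prefix-privileged

EventualPeriod : {A : Set} → (ℕ → A) → ℕ → ℕ → Set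
EventualPeriod w q K = ∀ i → K ≤ i → w i ≡ w (i + q)

module Periodic {A : Set} (w : ℕ → A) (p : ℕ) {{_ : NonZero p}} (K : ℕ)
                (periodic : EventualPeriod w p K) where
  open Factors w
  open Privileged-Factors w

  period-iterate : ∀ t j → K ≤ j → w j ≡ w (j + t * p)
  period-iterate zero    j _   = cong w (sym (+-identityʳ j))
  period-iterate (suc t) j K≤j = begin
      w j                ≡⟨ period-iterate t j K≤j ⟩
      w (j + t * p)      ≡⟨ periodic (j + t * p) (≤-trans K≤j (m≤m+n j (t * p))) ⟩
      w (j + t * p + p)  ≡⟨ cong w (trans (+-assoc j (t * p) p) (cong (j +_) (+-comm (t * p) p))) ⟩
      w (j + suc t * p)  ∎
    where open ≡-Reasoning

  same-suffix : ∀ {a j} → K ≤ a → a ≤ j → Σ ℕ λ r → r < p × (∀ k → w (a + r + k) ≡ w (j + k))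
  same-suffix {a} {j} K≤a a≤j = g % p , m%n<n g p , λ k → begin
      w (a + r + k)                ≡⟨ period-iterate q (a + r + k) (≤-trans K≤a (≤-trans (m≤m+n a r) (m≤m+n (a + r) k))) ⟩
      w (a + r + k + q * p)        ≡⟨ cong w (xy∙z≈xz∙y (a + r) k (q * p)) ⟩
      w (a + r + q * p + k)        ≡⟨ cong (λ x → w (x + k)) (+-assoc a r (q * p)) ⟩
      w (a + (r + q * p) + k)      ≡⟨ cong (λ x → w (a + x + k)) (m≡m%n+[m/n]*n g p) ⟨
      w (a + g + k)                ≡⟨ cong (λ x → w (x + k)) (m+[n∸m]≡n a≤j) ⟩
      w (j + k)                    ∎
    where
    open ≡-Reasoning
    g = j ∸ a
    r = g % p
    q = g / p

  agreement⇒period : ∀ {a e L} → K ≤ a → p ≤ L → Agree a (a + e) L → EventualPeriod w e a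
  agreement⇒period {a} {e} K≤a p≤L ag t a≤t with r , r<p , same ← same-suffix K≤a a≤t = begin
      w t              ≡⟨ reindex (+-identityʳ (a + r)) (+-identityʳ t) (same 0) ⟨
      w (a + r)        ≡⟨ ag r (<-≤-trans r<p p≤L) ⟩
      w (a + e + r)    ≡⟨ cong w (xy∙z≈xz∙y a e r) ⟩
      w (a + r + e)    ≡⟨ same e ⟩
      w (t + e)        ∎
    where open ≡-Reasoning

  -- Every return takes at most K + p steps: a return after d > K + p steps would already
  -- happen after d − p steps, since the shift by d − p > K lies in the periodic part of w.
  return-time-bounded : ∀ {i n} (R : Return i n) → Return.d R ≤ K + p
  return-time-bounded {i} R = ≮⇒≥ no-late-return
    where
    open Return R
    no-late-return : ¬ (K + p < d)
    no-late-return K+p<d = first j 0<j j<d earlier-return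
      where
      j = d ∸ p
      j+p≡d : j + p ≡ d
      j+p≡d = m∸n+n≡m (≤-trans (m≤n+m p K) (<⇒≤ K+p<d))
      K<j : K < j
      K<j = +-cancelʳ-< p K j (subst (K + p <_) (sym j+p≡d) K+p<d)
      0<j : 0 < j
      0<j = ≤-<-trans z≤n K<j
      j<d : j < d
      j<d = subst (j <_) j+p≡d (m<m+n j (>-nonZero⁻¹ p))
      regroup : ∀ i j p k → i + (j + p) + k ≡ i + j + k + p
      regroup = solve-∀
      earlier-return : Agree i (i + j) ℓ
      earlier-return k k<ℓ = begin
          w (i + k)            ≡⟨ returns k k<ℓ ⟩
          w (i + d + k)        ≡⟨ cong (λ x → w (i + x + k)) j+p≡d ⟨
          w (i + (j + p) + k)  ≡⟨ cong w (regroup i j p k) ⟩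
          w (i + j + k + p)    ≡⟨ periodic (i + j + k) (≤-trans (<⇒≤ K<j) (≤-trans (m≤n+m j i) (m≤m+n (i + j) k))) ⟨
          w (i + j + k)        ∎
        where open ≡-Reasoning

  -- Privileged factors longer than this bound are forced to occur past K.
  Bound : ℕ
  Bound = p + (K + K * p * (K + p))

  -- A privileged factor w[i, i + s) with s > Bound reoccurs at a position past K: shifting
  -- by M = K·p·d preserves its letters past K (a multiple of the period p), and its letters
  -- before K (a multiple of its return time d, which stays within the factor since d ≤ K + p).
  late-occurrence : ∀ {i s} → Privileged (factor w i s) → Bound < s → Σ ℕ λ i′ → K ≤ i′ × Agree i i′ s
  late-occurrence {i} {s} priv Bound<s = i + M , K≤i+M , shift-invariant
    where
    R : Return i s
    R = return-decomposition priv (≤-<-trans (≤-trans (>-nonZero⁻¹ p) (m≤m+n p _)) Bound<s)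
    open Return R
    M : ℕ
    M = K * p * d
    K≤i+M : K ≤ i + M
    K≤i+M = ≤-trans (m≤m*n K p) (≤-trans (m≤m*n (K * p) d {{>-nonZero 0<d}}) (m≤n+m M i))
    regroup : ∀ i k d K p → i + k + d * K * p ≡ i + K * p * d + k
    regroup = solve-∀
    shift-invariant : Agree i (i + M) s
    shift-invariant k k<s with K ≤? i + k
    ... | yes K≤i+k = trans (period-iterate (d * K) (i + k) K≤i+k) (cong w (regroup i k d K p))
    ... | no  i+k<K = trans (agree-iterate returns (K * p) k within) (cong w (xy∙z≈xz∙y i k (K * p * d)))
      where
      k<K : k < K
      k<K = ≤-<-trans (m≤n+m k i) (≰⇒> i+k<K)
      within : k + K * p * d < ℓ + d
      within = subst (k + K * p * d <_) (sym ℓ+d≡n) (begin-strict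
        k + K * p * d               <⟨ +-mono-<-≤ k<K (*-monoʳ-≤ (K * p) (return-time-bounded R)) ⟩
        K + K * p * (K + p)         ≤⟨ m≤n+m _ p ⟩
        Bound                       <⟨ Bound<s ⟩
        s                           ∎)
        where open ≤-Reasoning

  late-phase : ∀ {i s} → Privileged (factor w i s) → Bound < s →
               Σ ℕ λ r → r < p × factor w (K + r) s ≡ factor w i s
  late-phase {i} {s} priv Bound<s
    with i′ , K≤i′ , same-letters ← late-occurrence priv Bound<s
    with r , r<p , same-suffixes ← same-suffix ≤-refl K≤i′
    = r , r<p , Agree⇒factor≡ (K + r) i s λ k k<s → trans (same-suffixes k) (sym (same-letters k k<s))

module Least-Period {A : Set} (w : ℕ → A)
    (even : ∀ n → PrivCount w (2 * n) 1) (odd : ∀ n → PrivCount w (suc (2 * n)) 2)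
    (p : ℕ) {{_ : NonZero p}} (K : ℕ) (periodic : EventualPeriod w p K)
    (minimal : ∀ {e} → 0 < e → e < p → ∀ K′ → ¬ EventualPeriod w e K′) where
  open Factors w
  open Privileged-Factors w
  open Periodic w p K periodic

  PrivilegedAt : ℕ → ℕ → Set
  PrivilegedAt ℓ r = r < p × Privileged (factor w (K + r) ℓ)

  PrivilegedIn : ℕ → ℕ → ℕ → Set
  PrivilegedIn s t r = Σ ℕ λ ℓ → s ≤ ℓ × ℓ < t × PrivilegedAt ℓ r

  -- Privileged factors of different lengths ℓ < ℓ′ (with p ≤ ℓ) at the same phase have lengths
  -- at least p apart: the shorter is a border of the longer, so ℓ′ − ℓ is an eventual period.
  phase-separates : ∀ {ℓ ℓ′ r} → p ≤ ℓ → ℓ < ℓ′ → PrivilegedAt ℓ r → PrivilegedAt ℓ′ r → ℓ + p ≤ ℓ′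
  phase-separates {ℓ} {ℓ′} {r} p≤ℓ ℓ<ℓ′ (_ , privℓ) (_ , privℓ′)
    with g , ℓ+1+g≡ℓ′ ← m≤n⇒∃[o]m+o≡n ℓ<ℓ′ =
    subst (ℓ + p ≤_) ℓ+e≡ℓ′ (+-monoʳ-≤ ℓ (≮⇒≥ λ e<p → minimal (s≤s z≤n) e<p (K + r) period))
    where
    ℓ+e≡ℓ′ : ℓ + suc g ≡ ℓ′
    ℓ+e≡ℓ′ = trans (+-suc ℓ g) ℓ+1+g≡ℓ′
    period : EventualPeriod w (suc g) (K + r)
    period = agreement⇒period (m≤m+n K r) p≤ℓ
               (privileged-border ℓ′ (K + r) ℓ (suc g) ℓ+e≡ℓ′ privℓ′ privℓ)

  phase-of : ∀ {s u} → Bound < s → PrivFactor w s u → Σ ℕ λ r → PrivilegedAt s r × factor w (K + r) s ≡ u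
  phase-of Bound<s (privU , i , refl) with r , r<p , same ← late-phase privU Bound<s =
    r , (r<p , subst Privileged (sym same) privU) , same

  -- The phases of the k privileged factors of a length s > Bound: k pairwise distinct phases,
  -- since a factor is determined by its phase and length.
  phases-of-length : ∀ {s k} → Bound < s → PrivCount w s k →
                     Σ (List ℕ) λ rs → length rs ≡ k × Unique rs × All (PrivilegedAt s) rs
  phases-of-length {s} Bound<s (us , |us|≡k , unique , privileged , _)
    with rs , map≡us , phased ← preimage (λ r → factor w (K + r) s) us (All.map (phase-of Bound<s) privileged) =
    rs , trans (sym (length-map _ rs)) (trans (cong length map≡us) |us|≡k) ,
    Unique.map⁻ (subst Unique (sym map≡us) unique) , phased

  extend : ∀ {s t rs₁ rs₂} → p ≤ s → s < t → t ≤ s + p →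
           Unique rs₁ → All (PrivilegedAt s) rs₁ → Unique rs₂ → All (PrivilegedIn (suc s) t) rs₂ →
           Unique (rs₁ ++ rs₂) × All (PrivilegedIn s t) (rs₁ ++ rs₂)
  extend {s} {t} {rs₁} {rs₂} p≤s s<t t≤s+p unique₁ at₁ unique₂ in₂ =
    Unique.++⁺ unique₁ unique₂ disjoint ,
    All.++⁺ (All.map (λ at → s , ≤-refl , s<t , at) at₁)
            (All.map (λ (ℓ , s<ℓ , ℓ<t , at) → ℓ , <⇒≤ s<ℓ , ℓ<t , at) in₂)
    where
    disjoint : ∀ {r} → ¬ (r ∈ rs₁ × r ∈ rs₂)
    disjoint (r∈₁ , r∈₂) with ℓ , s<ℓ , ℓ<t , at ← All.lookup in₂ r∈₂ =
      <⇒≱ ℓ<t (≤-trans t≤s+p (phase-separates p≤s s<ℓ (All.lookup at₁ r∈₁) at))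

  count-positive : ∀ s → Σ ℕ λ k → 0 < k × PrivCount w s k
  count-positive s with even-or-odd s
  ... | inj₁ (q , refl) = 1 , s≤s z≤n , even q
  ... | inj₂ (q , refl) = 2 , s≤s z≤n , odd q

  -- The first length of the window of lengths [N, N + p) that is counted: odd and past Bound.
  N : ℕ
  N = suc (2 * Bound)

  Bound<N : Bound < N
  Bound<N = s≤s (m≤m+n Bound (Bound + 0))

  p≤N : p ≤ N
  p≤N = ≤-trans (m≤m+n p _) (<⇒≤ Bound<N)

  window : ∀ m s → N ≤ s → s + m ≤ N + p →
           Σ (List ℕ) λ rs → m ≤ length rs × Unique rs × All (PrivilegedIn s (s + m)) rs
  window zero    s _   _    = [] , z≤n , [] , []
  window (suc m) s N≤s fits
    with k , 0<k , count ← count-positive s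
    with rs₁ , |rs₁|≡k , unique₁ , at₁ ← phases-of-length (<-≤-trans Bound<N N≤s) count
    with rs₂ , m≤|rs₂| , unique₂ , in₂ ← window m (suc s) (≤-trans N≤s (n≤1+n s)) (subst (_≤ N + p) (+-suc s m) fits)
    with unique , inWindow ← extend (≤-trans p≤N N≤s) (m<m+n s z<s) (≤-trans fits (+-monoˡ-≤ p N≤s))
                                    unique₁ at₁ unique₂ (subst (λ t → All (PrivilegedIn (suc s) t) rs₂) (sym (+-suc s m)) in₂) =
    rs₁ ++ rs₂ ,
    subst (suc m ≤_) (sym (length-++ rs₁)) (+-mono-≤ (subst (1 ≤_) (sym |rs₁|≡k) 0<k) m≤|rs₂|) ,
    unique , inWindow

  upper-lengths-fit : suc N + pred p ≤ N + p
  upper-lengths-fit = ≤-reflexive (trans (sym (+-suc N (pred p))) (cong (N +_) (suc-pred p)))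

  -- The lengths N, …, N + p − 1 carry at least p + 1 distinct phases (two at the odd length N),
  -- yet all phases lie below p.
  impossible : ⊥
  impossible
    with rs₁ , |rs₁|≡2 , unique₁ , at₁ ← phases-of-length Bound<N (odd Bound)
    with rs₂ , p-1≤|rs₂| , unique₂ , in₂ ← window (pred p) (suc N) (n≤1+n N) upper-lengths-fit
    with unique , inWindow ← extend p≤N (s≤s (m≤m+n N (pred p))) upper-lengths-fit unique₁ at₁ unique₂ in₂ =
    <⇒≱ too-many (unique-below p (rs₁ ++ rs₂) unique (All.map (λ (_ , _ , _ , r<p , _) → r<p) inWindow))
    where
    too-many : p < length (rs₁ ++ rs₂)
    too-many = subst₂ _≤_ (cong suc (suc-pred p)) (sym (trans (length-++ rs₁) (cong (_+ length rs₂) |rs₁|≡2)))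
                 (s≤s (s≤s p-1≤|rs₂|))

no-eventual-period : {A : Set} (w : ℕ → A) →
                     (∀ n → PrivCount w (2 * n) 1) → (∀ n → PrivCount w (suc (2 * n)) 2) →
                     ∀ p → 0 < p → ∀ K → ¬ EventualPeriod w p K
no-eventual-period w even odd = <-rec _ λ p smaller 0<p K periodic →
  Least-Period.impossible w even odd p {{>-nonZero 0<p}} K periodic
    λ 0<e e<p K′ → smaller e<p 0<e K′

eventual-period : {A : Set} {w : ℕ → A} → UltimatelyPeriodic w →
                  Σ ℕ λ p → 0 < p × Σ ℕ λ K → EventualPeriod w p K
eventual-period {w = w} (u , a , vs , w≡uvω) = suc (length vs) , z<s , length u , λ i |u|≤i → begin
    w i                               ≡⟨ w≡uvω i ⟩
    uvω u a vs i                      ≡⟨ uvω-period u i |u|≤i ⟩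
    uvω u a vs (i + suc (length vs))  ≡⟨ w≡uvω (i + suc (length vs)) ⟨
    w (i + suc (length vs))           ∎
  where
  open ≡-Reasoning
  uvω-period : ∀ u i → length u ≤ i → uvω u a vs i ≡ uvω u a vs (i + suc (length vs))
  uvω-period []      i       _           =
    cong (lookup (a ∷ vs)) (fromℕ<-cong _ _ (sym ([m+n]%n≡m%n i (suc (length vs)))) _ _)
  uvω-period (x ∷ u) (suc i) (s≤s |u|≤i) = uvω-period u i |u|≤i

mainTheorem13 : {A : Set} (w : ℕ → A) →
                (∀ n → PrivCount w (2 * n) 1) →
                (∀ n → PrivCount w (suc (2 * n)) 2) →
                Aperiodic w
mainTheorem13 w even odd ultimately-periodic
  with p , 0<p , K , periodic ← eventual-period ultimately-periodic =
  no-eventual-period w even odd p 0<p K periodic
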